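{- Let $q\ge2$ and let $b$ be a digital function in base $q$ with block length $m\ge1$. Let $k>1$ be an integer with $\gcd(k,q-1)=1$ and $\gcd\bigl(k,\gcd(\{b(n):n\in\mathbb{N}\})\bigr)=1$. Then there exist integers $0\le \mathbf{e}_1,\mathbf{e}_2<q^{2m-1}$ such that $$b(q^{m-1}(\mathbf{e}_1+1)-1)-b(q^{m-1}(\mathbf{e}_1+1))\not\equiv b(q^{m-1}(\mathbf{e}_2+1)-1)-b(q^{m-1}(\mathbf{e}_2+1))\pmod k.$$
   Context: $\varepsilon_j(n)$ is the $j$-th base-$q$ digit of the nonnegative integer $n$, with $\varepsilon_j(n)=0$ for $j<0$. A digital function with block length $m$ is $b(n)=\sum_{j\in\mathbb{Z}}F(\varepsilon_{j+m-1}(n),\dots,\varepsilon_j(n))$ for some $F:\{0,\dots,q-1\}^m\to\mathbb{N}$ with $F(0,\dots,0)=0$. -}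

module Defs where

open import Data.Nat using (ℕ; zero; suc; _+_; _∸_; _≤_; _≤ᵇ_; NonZero)
open import Data.Nat.DivMod using (_/_; _mod_)
open import Data.Nat.Divisibility using (_∣_)
open import Data.Fin using (Fin; toℕ)
open import Data.Vec using (Vec; tabulate; replicate)
open import Data.List using (map; upTo)
open import Data.Nat.ListAction using (sum)
open import Data.Bool using (if_then_else_)
open import Data.Product using (_×_)

digit : (q : ℕ) .{{_ : NonZero q}} → ℕ → ℕ → Fin q
digit q zero    n = n mod q
digit q (suc j) n = digit q j (n / q)

zeroDigit : (q : ℕ) .{{_ : NonZero q}} → Fin q
zeroDigit q = 0 mod q

-- ε_{i ∸ t}(n) if t ≤ i, and 0 (digit of negative index) otherwise
shiftedDigit : (q : ℕ) .{{_ : NonZero q}} → ℕ → ℕ → ℕ → Fin q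
shiftedDigit q i t n = if t ≤ᵇ i then digit q (i ∸ t) n else zeroDigit q

-- the window (ε_{j+m-1}(n), …, ε_j(n)) with j = i - (m-1), i.e. i = j + m - 1
window : (q : ℕ) .{{_ : NonZero q}} (m : ℕ) → ℕ → ℕ → Vec (Fin q) m
window q m i n = tabulate (λ t → shiftedDigit q i (toℕ t) n)

-- digital function b(n) = Σ_{j ∈ ℤ} F(ε_{j+m-1}(n), …, ε_j(n)).
-- Reindexing by i = j + m - 1: all terms with i < 0 (j < -(m-1)) have all digits 0,
-- and all terms with i ≥ n + m have all digits 0 (since n < q^n); as F(0,…,0) = 0
-- these vanish, so the sum over i < n + m is the full sum.
digitalFunction : (q : ℕ) .{{_ : NonZero q}} (m : ℕ) → (Vec (Fin q) m → ℕ) → ℕ → ℕ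
digitalFunction q m F n = sum (map (λ i → F (window q m i n)) (upTo (n + m)))

IsSetGCD : (ℕ → ℕ) → ℕ → Set
IsSetGCD f g = (∀ n → g ∣ f n) × (∀ d → (∀ n → d ∣ f n) → d ∣ g)

module Submission where

open import Defs
open import Data.Nat using (ℕ; _+_; _∸_; _*_; _^_; _≤_; _<_; NonZero)
open import Data.Nat.GCD using (gcd)
open import Data.Fin using (Fin)
open import Data.Vec using (Vec; replicate)
open import Data.Integer using (ℤ; +_; _-_)
open import Data.Integer.Divisibility using (_∣_)
open import Data.Product using (Σ; _×_)
open import Relation.Nullary using (¬_)
open import Relation.Binary.PropositionalEquality using (_≡_)

open import Data.Nat using (zero; suc; _≤ᵇ_; z≤n; s≤s; z<s; s<s; >-nonZero)
open import Data.Nat.Properties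
open import Data.Nat.DivMod
  using (_/_; _%_; m≡m%n+[m/n]*n; m%n<n; %-remove-+ˡ; +-distrib-/-∣ˡ; m*n/n≡m; m<n*o⇒m/o<n; m/n<m; 0/n≡0)
open import Data.Nat.Divisibility as ℕᵈ using (divides) renaming (_∣_ to _∣ℕ_)
open import Data.Nat.Coprimality using (coprime-divisor; gcd≡1⇒coprime)
open import Data.Nat.Induction using (<-rec)
open import Data.Nat.ListAction using (sum)
open import Data.Nat.Tactic.RingSolver renaming (solve-∀ to solve-ℕ)
open import Data.Integer using (-_)
import Data.Integer as ℤ
import Data.Integer.Properties as ℤₚ
open import Data.Integer.Divisibility.Signed
  using (∣m∣n⇒∣m+n; ∣m⇒∣-m; ∣n⇒∣m*n; ∣ᵤ⇒∣; ∣⇒∣ᵤ) renaming (_∣_ to _∣ˢ_; divides to dividesˢ)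
open import Data.Integer.Tactic.RingSolver using (solve-∀)
open import Data.Fin using (toℕ; fromℕ<)
open import Data.Fin.Properties using (fromℕ<-cong; toℕ<n; toℕ-fromℕ<; ¬∀⟶∃¬)
open import Data.Vec.Properties using (tabulate-cong; tabulate∘lookup; lookup-replicate)
open import Data.List using (map; applyUpTo)
open import Data.Bool using (true; false)
open import Data.Unit using (tt)
open import Data.Empty using (⊥-elim)
open import Data.Product using (_,_; proj₁; proj₂)
open import Algebra.Properties.CommutativeSemigroup +-commutativeSemigroup using (xy∙z≈x∙zy; xy∙z≈xz∙y)
open import Function using (id; _∘_)
open import Relation.Nullary using (yes; no)
open import Relation.Binary.Bundles using (Setoid)
open import Relation.Binary.PropositionalEquality using (refl; sym; trans; cong; cong₂; subst; module ≡-Reasoning)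
import Relation.Binary.Reasoning.Setoid as SetoidReasoning

-- Write m = M + 1, Q = q^M, P = q^m, b for the digital function and
-- D(e) = b(Q(e+1) - 1) - b(Q(e+1)).  It suffices to show that the values D(e),
-- e < QP = q^(2m-1), are not all congruent to D(0) modulo k; a witness e₁ (with e₂ = 0)
-- is then found by a finite search.  Two structural facts about digital functions drive
-- the argument:
--   * shift invariance  b(q^c·n) = b(n): appended zero digits only add zero windows;
--   * locality  b(y·t·r) + b(t) = b(t·r) + b(y·t)  for digit blocks y, t, r with t of
--     length ≥ m - 1, because no window meets both y and r.
-- If all D(e) ≡ D(0), locality with r = (q-1)…(q-1) shows that the increments of b are
-- Q-periodic modulo k on [0, QP); summing one period gives b(x+1) - b(x) ≡ b(1), so
-- b(x) ≡ x·b(1) on [0, P].  As b(q) = b(1) and gcd(k, q-1) = 1, k divides b(1) and hence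
-- b on [0, P]; locality with a one-digit block r spreads this to all of ℕ.  So k divides
-- gcd(b), which is coprime to k, forcing k = 1.
-- The file develops, in order: arithmetic and finite sums, digits and windows, digital
-- functions (shift invariance, locality, propagation of divisibility), congruences
-- modulo k with telescoping sums, the main argument, and finally the theorem.

div-mod : ∀ n d .{{_ : NonZero d}} → n ≡ d * (n / d) + n % d
div-mod n d = trans (m≡m%n+[m/n]*n n d) (trans (+-comm (n % d) _) (cong (_+ n % d) (*-comm (n / d) d)))

affine-bound : ∀ {a t r B} → r < a → t < B → a * t + r < a * B
affine-bound {a} {t} {r} {B} r<a t<B = begin-strict
  a * t + r   <⟨ +-monoʳ-< (a * t) r<a ⟩
  a * t + a   ≡⟨ +-comm (a * t) a ⟩
  a + a * t   ≡⟨ *-suc a t ⟨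
  a * suc t   ≤⟨ *-monoʳ-≤ a t<B ⟩
  a * B       ∎
  where open ≤-Reasoning

ℕ-sum-in-ℤ : ∀ {a c} d e → a + c ≡ d + e → + a ≡ (+ d ℤ.+ + e) - + c
ℕ-sum-in-ℤ {a} {c} d e a+c≡d+e = begin
  + a                    ≡⟨ add-sub (+ a) (+ c) ⟩
  (+ a ℤ.+ + c) - + c    ≡⟨ cong (_- + c) (trans (sym (ℤₚ.pos-+ a c)) (trans (cong +_ a+c≡d+e) (ℤₚ.pos-+ d e))) ⟩
  (+ d ℤ.+ + e) - + c    ∎
  where
  open ≡-Reasoning
  add-sub : ∀ x y → x ≡ (x ℤ.+ y) - y
  add-sub = solve-∀

sumBelow : ℕ → (ℕ → ℕ) → ℕ
sumBelow zero    f = 0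
sumBelow (suc N) f = f 0 + sumBelow N (f ∘ suc)

sum-applyUpTo : ∀ (f g : ℕ → ℕ) N → sum (map f (applyUpTo g N)) ≡ sumBelow N (f ∘ g)
sum-applyUpTo f g zero    = refl
sum-applyUpTo f g (suc N) = cong (λ z → f (g 0) + z) (sum-applyUpTo f (g ∘ suc) N)

sumBelow-split : ∀ (f : ℕ → ℕ) a N → sumBelow (a + N) f ≡ sumBelow a f + sumBelow N (λ i → f (a + i))
sumBelow-split f zero    N = refl
sumBelow-split f (suc a) N = trans (cong (λ z → f 0 + z) (sumBelow-split (f ∘ suc) a N))
                                   (sym (+-assoc (f 0) _ _))

sumBelow-cong : ∀ {f g : ℕ → ℕ} N → (∀ i → i < N → f i ≡ g i) → sumBelow N f ≡ sumBelow N g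
sumBelow-cong zero    _ = refl
sumBelow-cong (suc N) h = cong₂ _+_ (h 0 z<s) (sumBelow-cong N (λ i i<N → h (suc i) (s<s i<N)))

sumBelow-zero : ∀ {f : ℕ → ℕ} N → (∀ i → i < N → f i ≡ 0) → sumBelow N f ≡ 0
sumBelow-zero zero    _ = refl
sumBelow-zero (suc N) h = cong₂ _+_ (h 0 z<s) (sumBelow-zero N (λ i i<N → h (suc i) (s<s i<N)))

sumBelow-extend : ∀ {f : ℕ → ℕ} {A N} → A ≤ N → (∀ i → A ≤ i → f i ≡ 0) → sumBelow N f ≡ sumBelow A f
sumBelow-extend {f} {A} {N} A≤N h = begin
  sumBelow N f                                        ≡⟨ cong (λ n → sumBelow n f) (sym (m+[n∸m]≡n A≤N)) ⟩
  sumBelow (A + (N ∸ A)) f                            ≡⟨ sumBelow-split f A (N ∸ A) ⟩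
  sumBelow A f + sumBelow (N ∸ A) (λ i → f (A + i))   ≡⟨ cong (λ z → sumBelow A f + z) (sumBelow-zero (N ∸ A) (λ i _ → h (A + i) (m≤m+n A i))) ⟩
  sumBelow A f + 0                                    ≡⟨ +-identityʳ _ ⟩
  sumBelow A f                                        ∎
  where open ≡-Reasoning

module Digits (q : ℕ) .{{_ : NonZero q}} where

  div-step : ∀ y a → (q * y + a) / q ≡ y + a / q
  div-step y a = trans (+-distrib-/-∣ˡ a (divides y (*-comm q y)))
                       (cong (_+ a / q) (trans (cong (_/ q) (*-comm q y)) (m*n/n≡m y q)))

  digit-base : ∀ y a → digit q 0 (q * y + a) ≡ digit q 0 a
  digit-base y a = fromℕ<-cong _ _ (%-remove-+ˡ a (divides y (*-comm q y))) _ _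

  digit-low : ∀ {j J} x a → j < J → digit q j (q ^ J * x + a) ≡ digit q j a
  digit-low {zero}  {suc J} x a _ = begin
    digit q 0 (q ^ suc J * x + a)   ≡⟨ cong (λ z → digit q 0 (z + a)) (*-assoc q (q ^ J) x) ⟩
    digit q 0 (q * (q ^ J * x) + a) ≡⟨ digit-base (q ^ J * x) a ⟩
    digit q 0 a                     ∎
    where open ≡-Reasoning
  digit-low {suc j} {suc J} x a (s≤s j<J) = begin
    digit q j ((q ^ suc J * x + a) / q)   ≡⟨ cong (λ z → digit q j ((z + a) / q)) (*-assoc q (q ^ J) x) ⟩
    digit q j ((q * (q ^ J * x) + a) / q) ≡⟨ cong (digit q j) (div-step (q ^ J * x) a) ⟩
    digit q j (q ^ J * x + a / q)         ≡⟨ digit-low x (a / q) j<J ⟩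
    digit q j (a / q)                     ∎
    where open ≡-Reasoning

  digit-shift : ∀ c j n {r} → r < q ^ c → digit q (c + j) (q ^ c * n + r) ≡ digit q j n
  digit-shift zero    j n {suc r} (s≤s ())
  digit-shift zero    j n {zero}  _ = cong (digit q j) (trans (+-identityʳ _) (*-identityˡ n))
  digit-shift (suc c) j n {r} r<q^c = begin
    digit q (c + j) ((q ^ suc c * n + r) / q)   ≡⟨ cong (λ z → digit q (c + j) ((z + r) / q)) (*-assoc q (q ^ c) n) ⟩
    digit q (c + j) ((q * (q ^ c * n) + r) / q) ≡⟨ cong (digit q (c + j)) (div-step (q ^ c * n) r) ⟩
    digit q (c + j) (q ^ c * n + r / q)         ≡⟨ digit-shift c j n (m<n*o⇒m/o<n (subst (r <_) (*-comm q (q ^ c)) r<q^c)) ⟩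
    digit q j n                                 ∎
    where open ≡-Reasoning

  digit-zero : ∀ j → digit q j 0 ≡ zeroDigit q
  digit-zero zero    = refl
  digit-zero (suc j) = trans (cong (digit q j) (0/n≡0 q)) (digit-zero j)

  exponent<power : 2 ≤ q → ∀ p → p < q ^ p
  exponent<power _ zero = s≤s z≤n
  exponent<power q≥2 (suc p) = begin-strict
    suc p          ≡⟨ +-comm 1 p ⟩
    p + 1          <⟨ +-mono-≤ (exponent<power q≥2 p) (m^n>0 q p) ⟩
    q ^ p + q ^ p  ≡⟨ cong (λ z → q ^ p + z) (sym (+-identityʳ (q ^ p))) ⟩
    2 * q ^ p      ≤⟨ *-monoˡ-≤ (q ^ p) q≥2 ⟩
    q ^ suc p      ∎
    where open ≤-Reasoning

  digit-beyond : 2 ≤ q → ∀ {p n} → n < p → digit q p n ≡ zeroDigit q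
  digit-beyond q≥2 {p} {n} n<p = begin
    digit q p n                     ≡⟨ cong₂ (digit q) (sym (+-identityʳ p)) (cong (_+ n) (sym (*-zeroʳ (q ^ p)))) ⟩
    digit q (p + 0) (q ^ p * 0 + n) ≡⟨ digit-shift p 0 0 (<-trans n<p (exponent<power q≥2 p)) ⟩
    digit q 0 0                     ∎
    where open ≡-Reasoning

  shifted-in : ∀ {i t} n → t ≤ i → shiftedDigit q i t n ≡ digit q (i ∸ t) n
  shifted-in {i} {t} n t≤i with t ≤ᵇ i | ≤⇒≤ᵇ t≤i
  ... | true | _ = refl

  shifted-out : ∀ {i t} n → i < t → shiftedDigit q i t n ≡ zeroDigit q
  shifted-out {i} {t} n i<t with t ≤ᵇ i | ≤ᵇ⇒≤ t i
  ... | true  | t≤i = ⊥-elim (<⇒≱ i<t (t≤i tt))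
  ... | false | _   = refl

module Windows (q : ℕ) .{{_ : NonZero q}} (m : ℕ) where
  open Digits q

  zeroWindow : Vec (Fin q) m
  zeroWindow = replicate m (zeroDigit q)

  window-cong : ∀ {i n i′ n′} → (∀ t → t < m → shiftedDigit q i t n ≡ shiftedDigit q i′ t n′) →
                window q m i n ≡ window q m i′ n′
  window-cong h = tabulate-cong (λ t → h (toℕ t) (toℕ<n t))

  window-zero : ∀ {i n} → (∀ t → t < m → shiftedDigit q i t n ≡ zeroDigit q) → window q m i n ≡ zeroWindow
  window-zero h = trans (tabulate-cong (λ t → trans (h (toℕ t) (toℕ<n t)) (sym (lookup-replicate t (zeroDigit q)))))
                        (tabulate∘lookup zeroWindow)

  window-of-zero : ∀ i → window q m i 0 ≡ zeroWindow
  window-of-zero i = window-zero (λ t _ → shifted-of-zero t)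
    where
    shifted-of-zero : ∀ t → shiftedDigit q i t 0 ≡ zeroDigit q
    shifted-of-zero t with t ≤? i
    ... | yes t≤i = trans (shifted-in 0 t≤i) (digit-zero (i ∸ t))
    ... | no  t≰i = shifted-out 0 (≰⇒> t≰i)

  window-high : 2 ≤ q → ∀ {i n} → n + m ≤ i → window q m i n ≡ zeroWindow
  window-high q≥2 {i} {n} n+m≤i = window-zero λ t t<m →
    let n+t<i : n + t < i
        n+t<i = <-≤-trans (+-monoʳ-< n t<m) n+m≤i
    in trans (shifted-in n (≤-trans (m≤n+m t n) (<⇒≤ n+t<i)))
             (digit-beyond q≥2 (m+n≤o⇒m≤o∸n (suc n) n+t<i))

  window-low : ∀ {i J} x a → i < J → window q m i (q ^ J * x + a) ≡ window q m i a
  window-low {i} {J} x a i<J = window-cong λ t _ → shifted-low t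
    where
    shifted-low : ∀ t → shiftedDigit q i t (q ^ J * x + a) ≡ shiftedDigit q i t a
    shifted-low t with t ≤? i
    ... | yes t≤i = trans (shifted-in _ t≤i)
                    (trans (digit-low x a (≤-<-trans (m∸n≤m i t) i<J)) (sym (shifted-in a t≤i)))
    ... | no  t≰i = trans (shifted-out _ (≰⇒> t≰i)) (sym (shifted-out a (≰⇒> t≰i)))

  shifted-shift : ∀ c {i t} n {r} → t ≤ i → r < q ^ c →
                  shiftedDigit q (c + i) t (q ^ c * n + r) ≡ shiftedDigit q i t n
  shifted-shift c {i} {t} n {r} t≤i r<q^c = begin
    shiftedDigit q (c + i) t (q ^ c * n + r) ≡⟨ shifted-in _ (≤-trans t≤i (m≤n+m i c)) ⟩
    digit q (c + i ∸ t) (q ^ c * n + r)      ≡⟨ cong (λ j → digit q j (q ^ c * n + r)) (+-∸-assoc c t≤i) ⟩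
    digit q (c + (i ∸ t)) (q ^ c * n + r)    ≡⟨ digit-shift c (i ∸ t) n r<q^c ⟩
    digit q (i ∸ t) n                        ≡⟨ shifted-in n t≤i ⟨
    shiftedDigit q i t n                     ∎
    where open ≡-Reasoning

  window-shift : ∀ c {i} n {r} → m ≤ suc i → r < q ^ c → window q m (c + i) (q ^ c * n + r) ≡ window q m i n
  window-shift c n m≤1+i r<q^c = window-cong λ t t<m → shifted-shift c n (≤-pred (≤-trans t<m m≤1+i)) r<q^c

  window-shift-exact : ∀ c i n → window q m (c + i) (q ^ c * n + 0) ≡ window q m i n
  window-shift-exact c i n = window-cong λ t _ → shifted-exact t
    where
    shifted-exact : ∀ t → shiftedDigit q (c + i) t (q ^ c * n + 0) ≡ shiftedDigit q i t n
    shifted-exact t with t ≤? i | t ≤? c + i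
    ... | yes t≤i | _        = shifted-shift c n t≤i (m^n>0 q c)
    ... | no  t≰i | yes t≤c+i = begin
      shiftedDigit q (c + i) t (q ^ c * n + 0) ≡⟨ shifted-in _ t≤c+i ⟩
      digit q (c + i ∸ t) (q ^ c * n + 0)      ≡⟨ digit-low n 0 c+i∸t<c ⟩
      digit q (c + i ∸ t) 0                    ≡⟨ digit-zero (c + i ∸ t) ⟩
      zeroDigit q                              ≡⟨ shifted-out n (≰⇒> t≰i) ⟨
      shiftedDigit q i t n                     ∎
      where
      open ≡-Reasoning
      c+i∸t<c : c + i ∸ t < c
      c+i∸t<c = subst (c + i ∸ t <_) (m+n∸n≡m c i) (∸-monoʳ-< (≰⇒> t≰i) t≤c+i)
    ... | no  t≰i | no t≰c+i = trans (shifted-out _ (≰⇒> t≰c+i)) (sym (shifted-out n (≰⇒> t≰i)))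

module DigitalFunctions (q : ℕ) .{{_ : NonZero q}} (q≥2 : 2 ≤ q) (m : ℕ)
                        (F : Vec (Fin q) m → ℕ) (F-zero : F (replicate m (zeroDigit q)) ≡ 0) where
  open Windows q m

  b : ℕ → ℕ
  b = digitalFunction q m F

  term : ℕ → ℕ → ℕ
  term n i = F (window q m i n)

  term-zero : ∀ {n i} → window q m i n ≡ zeroWindow → term n i ≡ 0
  term-zero w = trans (cong F w) F-zero

  b-as-sum : ∀ n {N} → n + m ≤ N → b n ≡ sumBelow N (term n)
  b-as-sum n n+m≤N = trans (sum-applyUpTo (term n) id (n + m))
                             (sym (sumBelow-extend n+m≤N (λ i le → term-zero (window-high q≥2 le))))

  b-split : ∀ n J N → n + m ≤ J + N → b n ≡ sumBelow J (term n) + sumBelow N (λ i → term n (J + i))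
  b-split n J N le = trans (b-as-sum n le) (sumBelow-split (term n) J N)

  b-zero : b 0 ≡ 0
  b-zero = trans (b-as-sum 0 ≤-refl) (sumBelow-zero m (λ i _ → term-zero (window-of-zero i)))

  ≤-shifted : ∀ c n r → n ≤ q ^ c * n + r
  ≤-shifted c n r = ≤-trans (m≤n*m n (q ^ c) {{m^n≢0 q c}}) (m≤m+n (q ^ c * n) r)

  b-shift : ∀ c n → b (q ^ c * n) ≡ b n
  b-shift c n = begin
    b (q ^ c * n)                                              ≡⟨ cong b (sym (+-identityʳ (q ^ c * n))) ⟩
    b X                                                        ≡⟨ b-split X c N (m≤n+m (X + m) c) ⟩
    sumBelow c (term X) + sumBelow N (λ i → term X (c + i))    ≡⟨ cong₂ _+_ lower-vanish upper-shift ⟩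
    0 + sumBelow N (term n)                                    ≡⟨ b-as-sum n (+-monoˡ-≤ m (≤-shifted c n 0)) ⟨
    b n                                                        ∎
    where
    open ≡-Reasoning
    X N : ℕ
    X = q ^ c * n + 0
    N = X + m
    lower-vanish : sumBelow c (term X) ≡ 0
    lower-vanish = sumBelow-zero c (λ i i<c → term-zero (trans (window-low n 0 i<c) (window-of-zero i)))
    upper-shift : sumBelow N (λ i → term X (c + i)) ≡ sumBelow N (term n)
    upper-shift = sumBelow-cong N (λ i _ → cong F (window-shift-exact c i n))

  -- When windows have length m ≤ M + 1, the windows of q^c·y + r (r < q^c) ending at
  -- positions ≥ c + M are exactly the windows of y ending at positions ≥ M.
  b-split-shift : ∀ {M} c y {r} → m ≤ suc M → r < q ^ c →
                  b (q ^ c * y + r) + sumBelow M (term y) ≡ sumBelow (c + M) (term (q ^ c * y + r)) + b y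
  b-split-shift {M} c y {r} m≤1+M r<q^c = begin
    b X + A                                                        ≡⟨ cong (_+ A) (b-split X (c + M) N (m≤n+m N (c + M))) ⟩
    (L + sumBelow N (λ i → term X (c + M + i))) + A                ≡⟨ cong (λ u → (L + u) + A) (sumBelow-cong N upper) ⟩
    (L + U) + A                                                    ≡⟨ xy∙z≈x∙zy L U A ⟩
    L + (A + U)                                                    ≡⟨ cong (λ z → L + z) (b-split y M N y+m≤M+N) ⟨
    L + b y                                                        ∎
    where
    open ≡-Reasoning
    X N A L U : ℕ
    X = q ^ c * y + r
    N = X + m
    A = sumBelow M (term y)
    L = sumBelow (c + M) (term X)
    U = sumBelow N (λ i → term y (M + i))
    upper : ∀ i → i < N → term X (c + M + i) ≡ term y (M + i)
    upper i _ = trans (cong (term X) (+-assoc c M i))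
                      (cong F (window-shift c y (≤-trans m≤1+M (s≤s (m≤m+n M i))) r<q^c))
    y+m≤M+N : y + m ≤ M + N
    y+m≤M+N = ≤-trans (+-monoˡ-≤ m (≤-shifted c y r)) (m≤n+m N M)

  -- Locality: if t has (at most) M ≥ m - 1 digits, then in the digit string y·t·r the
  -- windows meeting r see only t·r and the others see only y·t, so
  --   b(y·t·r) + b(t) = b(t·r) + b(y·t).
  locality : ∀ {M} c y {t r} → m ≤ suc M → t < q ^ M → r < q ^ c →
             b (q ^ c * (q ^ M * y + t) + r) + b t ≡ b (q ^ c * t + r) + b (q ^ M * y + t)
  locality {M} c y {t} {r} m≤1+M t<q^M r<q^c = +-cancelʳ-≡ A _ _ (begin
    (b X₁ + b t) + A   ≡⟨ xy∙z≈xz∙y (b X₁) (b t) A ⟩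
    (b X₁ + A) + b t   ≡⟨ cong (_+ b t) upper-y ⟩
    (L + b Y) + b t    ≡⟨ xy∙z≈xz∙y L (b Y) (b t) ⟩
    (L + b t) + b Y    ≡⟨ cong (_+ b Y) upper-t ⟨
    (b X₀ + A) + b Y   ≡⟨ xy∙z≈xz∙y (b X₀) A (b Y) ⟩
    (b X₀ + b Y) + A   ∎)
    where
    open ≡-Reasoning
    Y X₁ X₀ A L : ℕ
    Y  = q ^ M * y + t
    X₁ = q ^ c * Y + r
    X₀ = q ^ c * t + r
    A  = sumBelow M (term t)
    L  = sumBelow (c + M) (term X₀)
    X₁-digits : X₁ ≡ q ^ (c + M) * y + X₀
    X₁-digits = trans (factorise (q ^ c) (q ^ M) y t r) (cong (λ p → p * y + X₀) (sym (^-distribˡ-+-* q c M)))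
      where
      factorise : ∀ a p y t r → a * (p * y + t) + r ≡ a * p * y + (a * t + r)
      factorise = solve-ℕ
    low-Y : sumBelow M (term Y) ≡ A
    low-Y = sumBelow-cong M (λ i i<M → cong F (window-low y t i<M))
    low-X₁ : sumBelow (c + M) (term X₁) ≡ L
    low-X₁ = sumBelow-cong (c + M) (λ i i<c+M →
               cong F (trans (cong (window q m i) X₁-digits) (window-low y X₀ i<c+M)))
    upper-y : b X₁ + A ≡ L + b Y
    upper-y = trans (cong (λ z → b X₁ + z) (sym low-Y))
                    (trans (b-split-shift c Y m≤1+M r<q^c) (cong (_+ b Y) low-X₁))
    upper-t : b X₀ + A ≡ L + b t
    upper-t = b-split-shift c t m≤1+M r<q^c

  -- A common divisor of the values b n for n < q^(M+1) divides every value of b: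
  -- by locality with c = 1, b(n) = b(q·t + r) + b(n / q) - b(t) with q·t + r, t < q^(M+1).
  divides-all : ∀ {M} d → m ≤ suc M → (∀ n → n < q ^ suc M → d ∣ℕ b n) → ∀ n → d ∣ℕ b n
  divides-all {M} d m≤1+M small = <-rec (λ n → d ∣ℕ b n) step
    where
    step : ∀ n → (∀ {y} → y < n → d ∣ℕ b y) → d ∣ℕ b n
    step n smaller with n <? q ^ suc M
    ... | yes n<q^[1+M] = small n n<q^[1+M]
    ... | no  n≮q^[1+M] = ℕᵈ.∣m+n∣m⇒∣n (subst (d ∣ℕ_) (sym split) (ℕᵈ.∣m∣n⇒∣m+n (small s s<) (smaller y<n))) (small t t<)
      where
      instance
        q^M-nonZero : NonZero (q ^ M)
        q^M-nonZero = m^n≢0 q M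
        n-nonZero : NonZero n
        n-nonZero = >-nonZero (<-≤-trans (m^n>0 q (suc M)) (≮⇒≥ n≮q^[1+M]))
      y r t s : ℕ
      y = n / q
      r = n % q
      t = y % q ^ M
      s = q * t + r
      s< : s < q ^ suc M
      s< = affine-bound (m%n<n n q) (m%n<n y (q ^ M))
      t< : t < q ^ suc M
      t< = <-≤-trans (m%n<n y (q ^ M)) (m≤n*m (q ^ M) q {{>-nonZero (<-≤-trans z<s q≥2)}})
      y<n : y < n
      y<n = m/n<m n q q≥2
      y₁ : ℕ
      y₁ = y / q ^ M
      y-digits : y ≡ q ^ M * y₁ + t
      y-digits = div-mod y (q ^ M)
      n-digits : n ≡ q ^ 1 * (q ^ M * y₁ + t) + r
      n-digits = trans (div-mod n q) (cong₂ (λ z w → z * w + r) (sym (*-identityʳ q)) y-digits)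
      split : b t + b n ≡ b s + b y
      split = begin
        b t + b n                                ≡⟨ +-comm (b t) (b n) ⟩
        b n + b t                                ≡⟨ cong (λ z → b z + b t) n-digits ⟩
        b (q ^ 1 * (q ^ M * y₁ + t) + r) + b t   ≡⟨ locality 1 y₁ m≤1+M (m%n<n y (q ^ M)) (subst (r <_) (sym (*-identityʳ q)) (m%n<n n q)) ⟩
        b (q ^ 1 * t + r) + b (q ^ M * y₁ + t)   ≡⟨ cong₂ (λ z w → b (z + r) + b w) (cong (_* t) (*-identityʳ q)) (sym y-digits) ⟩
        b s + b y                                ∎
        where open ≡-Reasoning

module Congruence (k : ℕ) where

  infix 4 _≈_
  record _≈_ (a b : ℤ) : Set where
    constructor ∣⇒≈
    field ≈⇒∣ : + k ∣ˢ a - b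
  open _≈_ public

  ≈-reflexive : ∀ {a b} → a ≡ b → a ≈ b
  ≈-reflexive {a} refl = ∣⇒≈ (dividesˢ (+ 0) (a-a≡0 a))
    where
    a-a≡0 : ∀ a → a - a ≡ + 0 ℤ.* + k
    a-a≡0 = solve-∀

  ≈-sym : ∀ {a b} → a ≈ b → b ≈ a
  ≈-sym {a} {b} (∣⇒≈ k∣a-b) = ∣⇒≈ (subst (+ k ∣ˢ_) (negate a b) (∣m⇒∣-m k∣a-b))
    where
    negate : ∀ a b → - (a - b) ≡ b - a
    negate = solve-∀

  ≈-trans : ∀ {a b c} → a ≈ b → b ≈ c → a ≈ c
  ≈-trans {a} {b} {c} (∣⇒≈ k∣a-b) (∣⇒≈ k∣b-c) = ∣⇒≈ (subst (+ k ∣ˢ_) (chain a b c) (∣m∣n⇒∣m+n k∣a-b k∣b-c))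
    where
    chain : ∀ a b c → (a - b) ℤ.+ (b - c) ≡ a - c
    chain = solve-∀

  ≈-+ : ∀ {a b c d} → a ≈ b → c ≈ d → a ℤ.+ c ≈ b ℤ.+ d
  ≈-+ {a} {b} {c} {d} (∣⇒≈ k∣a-b) (∣⇒≈ k∣c-d) = ∣⇒≈ (subst (+ k ∣ˢ_) (regroup a b c d) (∣m∣n⇒∣m+n k∣a-b k∣c-d))
    where
    regroup : ∀ a b c d → (a - b) ℤ.+ (c - d) ≡ (a ℤ.+ c) - (b ℤ.+ d)
    regroup = solve-∀

  ≈-setoid : Setoid _ _
  ≈-setoid = record
    { Carrier       = ℤ
    ; _≈_           = _≈_
    ; isEquivalence = record { refl = ≈-reflexive refl ; sym = ≈-sym ; trans = ≈-trans }
    }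

  module ≈-Reasoning = SetoidReasoning ≈-setoid

  telescope : ∀ (g h : ℕ → ℤ) T → (∀ t → t < T → g (suc t) - g t ≈ h (suc t) - h t) →
              g T - g 0 ≈ h T - h 0
  telescope g h zero    _   = ≈-reflexive (cancel (g 0) (h 0))
    where
    cancel : ∀ a b → a - a ≡ b - b
    cancel = solve-∀
  telescope g h (suc T) inc = begin
    g (suc T) - g 0                     ≡⟨ split (g (suc T)) (g T) (g 0) ⟩
    (g (suc T) - g T) ℤ.+ (g T - g 0)   ≈⟨ ≈-+ (inc T (n<1+n T)) (telescope g h T (λ t t<T → inc t (m<n⇒m<1+n t<T))) ⟩
    (h (suc T) - h T) ℤ.+ (h T - h 0)   ≡⟨ split (h (suc T)) (h T) (h 0) ⟨
    h (suc T) - h 0                     ∎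
    where
    open ≈-Reasoning
    split : ∀ a b c → a - c ≡ (a - b) ℤ.+ (b - c)
    split = solve-∀

module Argument (q : ℕ) .{{_ : NonZero q}} (q≥2 : 2 ≤ q) (M : ℕ)
                (F : Vec (Fin q) (suc M) → ℕ) (F-zero : F (replicate (suc M) (zeroDigit q)) ≡ 0)
                (k : ℕ) where
  open DigitalFunctions q q≥2 (suc M) F F-zero
  open Congruence k

  Q P : ℕ
  Q = q ^ M
  P = q ^ suc M

  instance
    Q-nonZero : NonZero Q
    Q-nonZero = m^n≢0 q M
    P-nonZero : NonZero P
    P-nonZero = m^n≢0 q (suc M)

  β : ℕ → ℤ
  β n = + b n

  D : ℕ → ℤ
  D e = β (Q * (e + 1) ∸ 1) - β (Q * (e + 1))

  β-shift : ∀ c n → β (q ^ c * n) ≡ β n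
  β-shift c n = cong +_ (b-shift c n)

  β-zero : β 0 ≡ + 0
  β-zero = cong +_ b-zero

  -- Since b(Q·n) = b(n), D e = b(Q·e + (Q - 1)) - b(e + 1).
  D-unfold : ∀ e → D e ≡ β (Q * e + (Q ∸ 1)) - β (suc e)
  D-unfold e = cong₂ _-_ (cong β last-digits) (trans (β-shift M (e + 1)) (cong β (+-comm e 1)))
    where
    last-digits : Q * (e + 1) ∸ 1 ≡ Q * e + (Q ∸ 1)
    last-digits = trans (cong (_∸ 1) (trans (*-distribˡ-+ Q e 1) (cong (λ z → Q * e + z) (*-identityʳ Q))))
                        (+-∸-assoc (Q * e) (m^n>0 q M))

  locality-top : ∀ x {t} → t < Q → β (Q * (Q * x + t) + (Q ∸ 1)) ≡ (β (Q * t + (Q ∸ 1)) ℤ.+ β (Q * x + t)) - β t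
  locality-top x {t} t<Q = ℕ-sum-in-ℤ (b (Q * t + (Q ∸ 1))) (b (Q * x + t)) (locality M x ≤-refl t<Q (∸-monoʳ-< z<s (m^n>0 q M)))

  D-difference : ∀ x {t} → t < Q → let e = Q * x + t in
                 D t - D e ≡ (β (suc e) - β e) - (β (suc t) - β t)
  D-difference x {t} t<Q = begin
    D t - D e                                             ≡⟨ cong₂ _-_ (D-unfold t) (D-unfold e) ⟩
    (C - β (suc t)) - (β (Q * e + (Q ∸ 1)) - β (suc e))   ≡⟨ cong (λ z → (C - β (suc t)) - (z - β (suc e))) (locality-top x t<Q) ⟩
    (C - β (suc t)) - (((C ℤ.+ β e) - β t) - β (suc e))   ≡⟨ rearrange C (β e) (β (suc e)) (β t) (β (suc t)) ⟩
    (β (suc e) - β e) - (β (suc t) - β t)                 ∎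
    where
    open ≡-Reasoning
    e : ℕ
    e = Q * x + t
    C : ℤ
    C = β (Q * t + (Q ∸ 1))
    rearrange : ∀ c x x′ y y′ → (c - y′) - (((c ℤ.+ x) - y) - x′) ≡ (x′ - x) - (y′ - y)
    rearrange = solve-∀

  module Consequences (congruent : ∀ e → e < Q * P → D e ≈ D 0) (coprime : gcd k (q ∸ 1) ≡ 1) where
    open ≈-Reasoning

    increment-periodic : ∀ {x t} → x < P → t < Q → β (Q * x + suc t) - β (Q * x + t) ≈ β (suc t) - β t
    increment-periodic {x} {t} x<P t<Q = ∣⇒≈ (subst (+ k ∣ˢ_) difference (≈⇒∣ Dt≈De))
      where
      e : ℕ
      e = Q * x + t
      Dt≈De : D t ≈ D e
      Dt≈De = ≈-trans (congruent t (<-≤-trans t<Q (m≤m*n Q P))) (≈-sym (congruent e (affine-bound t<Q x<P)))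
      difference : D t - D e ≡ (β (Q * x + suc t) - β e) - (β (suc t) - β t)
      difference = trans (D-difference x t<Q) (cong (λ z → (β z - β e) - (β (suc t) - β t)) (sym (+-suc (Q * x) t)))

    -- Summing over a block of Q increments: b(x + 1) - b(x) ≡ b(1) (mod k) for x < P.
    unit-increment : ∀ {x} → x < P → β (suc x) - β x ≈ β 1
    unit-increment {x} x<P = begin
      β (suc x) - β x                ≡⟨ cong₂ _-_ block-end block-start ⟨
      β (Q * x + Q) - β (Q * x + 0)  ≈⟨ telescope (λ t → β (Q * x + t)) β Q (λ t t<Q → increment-periodic x<P t<Q) ⟩
      β Q - β 0                      ≡⟨ cong₂ _-_ (trans (cong β (sym (*-identityʳ Q))) (β-shift M 1)) β-zero ⟩
      β 1 - + 0                      ≡⟨ ℤₚ.+-identityʳ (β 1) ⟩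
      β 1                            ∎
      where
      block-end : β (Q * x + Q) ≡ β (suc x)
      block-end = trans (cong β (trans (+-comm (Q * x) Q) (sym (*-suc Q x)))) (β-shift M (suc x))
      block-start : β (Q * x + 0) ≡ β x
      block-start = trans (cong β (+-identityʳ (Q * x))) (β-shift M x)

    linear : ∀ {x} → x ≤ P → β x ≈ + x ℤ.* β 1
    linear {x} x≤P = begin
      β x                          ≡⟨ trans (cong (λ z → β x - z) β-zero) (ℤₚ.+-identityʳ (β x)) ⟨
      β x - β 0                    ≈⟨ telescope β (λ t → + t ℤ.* β 1) x (λ t t<x →
                                        ≈-trans (unit-increment (<-≤-trans t<x x≤P)) (≈-reflexive (slope (+ t) (β 1)))) ⟩
      + x ℤ.* β 1 - + 0 ℤ.* β 1    ≡⟨ drop-zero (+ x) (β 1) ⟩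
      + x ℤ.* β 1                  ∎
      where
      slope : ∀ a s → s ≡ (+ 1 ℤ.+ a) ℤ.* s - a ℤ.* s
      slope = solve-∀
      drop-zero : ∀ a s → a ℤ.* s - + 0 ℤ.* s ≡ a ℤ.* s
      drop-zero = solve-∀

    -- b(q) = b(1) together with linearity gives (q - 1)·b(1) ≡ 0, so k ∣ b(1) when gcd(k, q-1) = 1.
    divides-b1 : k ∣ℕ b 1
    divides-b1 = coprime-divisor (gcd≡1⇒coprime coprime) (∣⇒∣ᵤ k∣[q-1]b1)
      where
      βq≡β1 : β q ≡ β 1
      βq≡β1 = trans (cong β (sym (trans (*-identityʳ (q ^ 1)) (*-identityʳ q)))) (β-shift 1 1)
      β1≈qβ1 : β 1 ≈ + q ℤ.* β 1
      β1≈qβ1 = ≈-trans (≈-reflexive (sym βq≡β1)) (linear (m≤m*n q Q))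
      q≡1+[q-1] : + q ≡ + 1 ℤ.+ + (q ∸ 1)
      q≡1+[q-1] = cong +_ (sym (m+[n∸m]≡n (<-≤-trans z<s q≥2)))
      factor : ∀ a s → - (s - (+ 1 ℤ.+ a) ℤ.* s) ≡ a ℤ.* s
      factor = solve-∀
      k∣[q-1]b1 : + k ∣ˢ + ((q ∸ 1) * b 1)
      k∣[q-1]b1 = subst (+ k ∣ˢ_) (trans (cong (λ z → - (β 1 - z ℤ.* β 1)) q≡1+[q-1])
                                         (trans (factor (+ (q ∸ 1)) (β 1)) (sym (ℤₚ.pos-* (q ∸ 1) (b 1)))))
                        (∣m⇒∣-m (≈⇒∣ β1≈qβ1))

    -- Every b(n) with n ≤ P is congruent to n·b(1), hence divisible by k.
    divides-below : ∀ {n} → n ≤ P → k ∣ℕ b n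
    divides-below {n} n≤P =
      ∣⇒∣ᵤ (subst (+ k ∣ˢ_) (sub-add (β n) (+ n ℤ.* β 1))
                  (∣m∣n⇒∣m+n (≈⇒∣ (linear n≤P)) (∣n⇒∣m*n (+ n) (∣ᵤ⇒∣ divides-b1))))
      where
      sub-add : ∀ a c → (a - c) ℤ.+ c ≡ a
      sub-add = solve-∀

    divides-every-value : ∀ n → k ∣ℕ b n
    divides-every-value = divides-all k ≤-refl (λ n n<P → divides-below (<⇒≤ n<P))


lemma5 : (q : ℕ) .{{_ : NonZero q}} → 2 ≤ q → (m : ℕ) → 1 ≤ m →
         (F : Vec (Fin q) m → ℕ) → F (replicate m (zeroDigit q)) ≡ 0 →
         (k : ℕ) → 1 < k → gcd k (q ∸ 1) ≡ 1 →
         Σ ℕ (λ g → IsSetGCD (digitalFunction q m F) g × gcd k g ≡ 1) →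
         Σ ℕ (λ e₁ → Σ ℕ (λ e₂ →
           e₁ < q ^ (2 * m ∸ 1) × e₂ < q ^ (2 * m ∸ 1) ×
           ¬ (+ k ∣ ((+ digitalFunction q m F (q ^ (m ∸ 1) * (e₁ + 1) ∸ 1)
                      - + digitalFunction q m F (q ^ (m ∸ 1) * (e₁ + 1)))
                     - (+ digitalFunction q m F (q ^ (m ∸ 1) * (e₂ + 1) ∸ 1)
                      - + digitalFunction q m F (q ^ (m ∸ 1) * (e₂ + 1)))))))
lemma5 q q≥2 zero () F F-zero k 1<k coprime-q _
lemma5 q q≥2 (suc M) _ F F-zero k 1<k coprime-q (g , (_ , g-greatest) , coprime-g) =
  toℕ (proj₁ witness) , 0 , toℕ<n (proj₁ witness) , m^n>0 q (2 * suc M ∸ 1) , proj₂ witness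
  where
  open Argument q q≥2 M F F-zero k
  open Congruence k
  N : ℕ
  N = q ^ (2 * suc M ∸ 1)
  N≡Q*P : N ≡ Q * P
  N≡Q*P = trans (cong (λ j → q ^ (M + j)) (+-identityʳ (suc M))) (^-distribˡ-+-* q M (suc M))
  -- If all D e (e < N) were congruent to D 0, then k would divide g = gcd(b), forcing k = 1.
  not-all-congruent : ¬ (∀ (i : Fin N) → + k ∣ (D (toℕ i) - D 0))
  not-all-congruent all = <⇒≢ 1<k (sym (gcd≡1⇒coprime coprime-g (ℕᵈ.∣-refl , g-greatest k k∣b)))
    where
    congruent : ∀ e → e < Q * P → D e ≈ D 0
    congruent e e<Q*P = ∣⇒≈ (∣ᵤ⇒∣ (subst (λ z → + k ∣ (D z - D 0)) (toℕ-fromℕ< e<N) (all (fromℕ< e<N))))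
      where
      e<N : e < N
      e<N = subst (e <_) (sym N≡Q*P) e<Q*P
    k∣b : ∀ n → k ∣ℕ digitalFunction q (suc M) F n
    k∣b = Consequences.divides-every-value congruent coprime-q
  -- Since divisibility is decidable, a finite search yields e₁ < N with D e₁ ≢ D 0.
  witness : Σ (Fin N) (λ i → ¬ (+ k ∣ (D (toℕ i) - D 0)))
  witness = ¬∀⟶∃¬ N _ (λ i → k ℕᵈ.∣? ℤ.∣ D (toℕ i) - D 0 ∣) not-all-congruent
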